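{- Let $P$ be a nondisjunctive acyclic CR-Prolog program. If $P$ has answer sets $X_1\subsetneq X_2$, then there exist literals $l_1$ and $l_2$ in $\mathrm{head}(P^{cr})$ (i.e. cr-literals of $P$) such that $l_1$ depends on $l_2$.
   Context: A literal is an atom $a$ or its classical negation $\neg a$; a context is a consistent set of literals (all contexts considered are consistent). A regular rule $r$ has the form $l_1 \vee \dots \vee l_k \leftarrow l_{k+1},\dots,l_m, \mathrm{not}\ l_{m+1},\dots,\mathrm{not}\ l_n$ with $1\le k\le m\le n$; $\mathrm{head}(r)=\{l_1,\dots,l_k\}$, $\mathrm{pos}(r)=\{l_{k+1},\dots,l_m\}$; $r$ is nondisjunctive if $k=1$. A context $X$ satisfies $r$ if, whenever $l_{k+1},\dots,l_m\in X$ and $l_{m+1},\dots,l_n\notin X$, some head literal is in $X$. An A-Prolog program is a finite set of regular rules. For a program without default negation, $X$ is an answer set if $X$ satisfies it and no proper subset does; in general, the reduct $P^X$ removes every rule containing $\mathrm{not}\ l$ with $l\in X$ and deletes the remaining $\mathrm{not}$-literals, and $X$ is an answer set of $P$ if it is an answer set of $P^X$; $P$ is consistent if it has an answer set. A cr-rule has the form $l_0 \stackrel{+}{\leftarrow} l_1,\dots,l_m,\mathrm{not}\ l_{m+1},\dots,\mathrm{not}\ l_n$ with $\mathrm{head}=\{l_0\}$ ($l_0$ is a cr-literal) and $\mathrm{pos}=\{l_1,\dots,l_m\}$; for a set $R$ of rules, $\mathrm{head}(R)=\bigcup_{r\in R}\mathrm{head}(r)$. A CR-Prolog program $P$ is a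 finite set of regular rules and cr-rules, $P^{reg}$ its regular rules, $P^{cr}$ its cr-rules; $P$ is nondisjunctive if all its regular rules are. $\alpha(r)$ is obtained from a cr-rule $r$ by replacing $\stackrel{+}{\leftarrow}$ by $\leftarrow$; $\alpha(R)=\{\alpha(r):r\in R\}$. $R\subseteq P^{cr}$ is an abductive support of $P$ if $P^{reg}\cup\alpha(R)$ is consistent and no $R'\subseteq P^{cr}$ with $|R'|<|R|$ makes $P^{reg}\cup\alpha(R')$ consistent. $X$ is an answer set of $P$ if it is an answer set of $P^{reg}\cup\alpha(R)$ for some abductive support $R$. The dependency graph of $P$ has the literals of $P$ as vertices and an edge from $l'$ to $l''$ iff some rule $r\in P$ (regular or cr-rule) has $l''\in\mathrm{head}(r)$, $l'\in\mathrm{pos}(r)$; $P$ is acyclic if this graph has no directed cycle. A literal $l_1$ depends on $l_2$ if the dependency graph has a directed path (with at least one edge) from $l_2$ to $l_1$. -}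

module Defs where

open import Data.Nat using (ℕ; _<_)
open import Data.Bool using (Bool; true; false; if_then_else_)
open import Data.List using (List; []; _∷_; map; length; _++_)
open import Data.Bool.ListAction using (any)
open import Data.List.Membership.Propositional using (_∈_)
open import Data.List.Relation.Unary.All using (All)
open import Data.List.Relation.Unary.Any using (Any)
open import Data.List.Relation.Binary.Sublist.Propositional using (_⊆_)
open import Data.Product using (Σ; _×_; ∃; ∃-syntax; _,_)
open import Data.Sum using (_⊎_)
open import Relation.Nullary using (¬_)
open import Relation.Binary.PropositionalEquality using (_≡_)
open import Relation.Binary.Construct.Closure.Transitive using (TransClosure)

-- Atoms are natural numbers; a literal is an atom or its classical negation.
data Lit : Set where
  pos : ℕ → Lit
  neg : ℕ → Lit

LitSet : Set
LitSet = Lit → Bool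

_∈ˢ_ : Lit → LitSet → Set
l ∈ˢ X = X l ≡ true

_∉ˢ_ : Lit → LitSet → Set
l ∉ˢ X = X l ≡ false

Consistent : LitSet → Set
Consistent X = ∀ a → ¬ (pos a ∈ˢ X × neg a ∈ˢ X)

_⊑_ : LitSet → LitSet → Set
Y ⊑ X = ∀ l → l ∈ˢ Y → l ∈ˢ X

_⊏_ : LitSet → LitSet → Set
Y ⊏ X = Y ⊑ X × ∃[ l ] (l ∈ˢ X × l ∉ˢ Y)

-- regular rule  h1 ∨ ... ∨ hk ← pos, not nots
record Rule : Set where
  constructor rule
  field
    head : List Lit
    body : List Lit
    nots : List Lit
open Rule public

-- cr-rule  l0 +← pos, not nots
record CRRule : Set where
  constructor crrule
  field
    crhead : Lit
    crbody : List Lit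
    crnots : List Lit
open CRRule public

record CRProgram : Set where
  constructor program
  field
    reg : List Rule
    cr  : List CRRule
open CRProgram public

Program : Set
Program = List Rule

Satisfies : LitSet → Rule → Set
Satisfies X r =
  All (_∈ˢ X) (body r) → All (_∉ˢ X) (nots r) → Any (_∈ˢ X) (head r)

SatisfiesP : LitSet → Program → Set
SatisfiesP X Q = All (Satisfies X) Q

reduct : Program → LitSet → Program
reduct [] X = []
reduct (r ∷ Q) X =
  if any X (nots r) then reduct Q X
  else rule (head r) (body r) [] ∷ reduct Q X

AnswerSetPositive : Program → LitSet → Set
AnswerSetPositive Q X =
  Consistent X × SatisfiesP X Q ×
  (∀ (Y : LitSet) → Consistent Y → Y ⊏ X → ¬ SatisfiesP Y Q)

AnswerSet : Program → LitSet → Set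
AnswerSet Q X = AnswerSetPositive (reduct Q X) X

ConsistentProgram : Program → Set
ConsistentProgram Q = Σ LitSet (AnswerSet Q)

α : CRRule → Rule
α r = rule (crhead r ∷ []) (crbody r) (crnots r)

withCR : CRProgram → List CRRule → Program
withCR P R = reg P ++ map α R

-- abductive support (subsets of P^cr represented as sublists)
AbductiveSupport : CRProgram → List CRRule → Set
AbductiveSupport P R =
  R ⊆ cr P × ConsistentProgram (withCR P R) ×
  (∀ (R' : List CRRule) → R' ⊆ cr P → length R' < length R →
     ¬ ConsistentProgram (withCR P R'))

CRAnswerSet : CRProgram → LitSet → Set
CRAnswerSet P X = ∃[ R ] (AbductiveSupport P R × AnswerSet (withCR P R) X)

Nondisjunctive : CRProgram → Set
Nondisjunctive P = All (λ r → length (head r) ≡ 1) (reg P)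

Edge : CRProgram → Lit → Lit → Set
Edge P l' l'' =
  (∃[ r ] (r ∈ reg P × l'' ∈ head r × l' ∈ body r)) ⊎
  (∃[ r ] (r ∈ cr P × l'' ≡ crhead r × l' ∈ crbody r))

Acyclic : CRProgram → Set
Acyclic P = ∀ l → ¬ TransClosure (Edge P) l l

DependsOn : CRProgram → Lit → Lit → Set
DependsOn P l1 l2 = TransClosure (Edge P) l2 l1

crHeads : CRProgram → List Lit
crHeads P = map crhead (cr P)

module Submission where

-- Let X₁ ⊏ X₂ be answer sets of P, obtained from abductive supports R₁ and R₂.
-- Minimality of R₂ gives |R₂| ≤ |R₁|.  Call a literal downstream if the
-- dependency graph has a (possibly empty) path to it from a fresh cr-literal,
-- i.e. a cr-literal in X₂ ∖ X₁.  If some cr-literal of X₁ is downstream, it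
-- depends on a fresh cr-literal and we are done.  Otherwise we reach a
-- contradiction.  Let T ⊆ R₂ be the cr-rules whose α-images X₁ satisfies.
--   * If T = R₂, then X₁ ⊏ X₂ is a model of the reduct (P^reg ∪ α(R₂))^X₂,
--     contradicting the minimality of X₂.
--   * Otherwise |T| < |R₁|, and X₁ is an answer set of P^reg ∪ α(T): for a
--     smaller model Y, the set Y ∪ (X₂ ∩ downstream) is a model of the reduct
--     of P^reg ∪ α(R₂), hence equals X₂ by minimality; this forces Y to also be
--     a model of the reduct of P^reg ∪ α(R₁), contradicting minimality of X₁.
--     So T is a smaller abductive support than R₁, again a contradiction.

open import Defs
open import Data.Product using (_×_; ∃-syntax; _,_; proj₁; proj₂)
open import Data.List.Membership.Propositional using (_∈_; find; lose)

open import Data.Bool as Bool using (true; false; _∨_; _∧_)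
open import Data.Bool.Properties using (¬-not; ∨-zeroʳ)
open import Data.Bool.ListAction using (any)
open import Data.Empty using (⊥; ⊥-elim)
open import Data.Nat.Properties using (≮⇒≥; <-≤-trans)
open import Data.List using (List; []; _∷_; _++_; length; concatMap; cartesianProduct; filter)
open import Data.List.Relation.Unary.All as All using (All; []; _∷_; all?)
open import Data.List.Relation.Unary.All.Properties as AllP using (¬All⇒Any¬)
open import Data.List.Relation.Unary.Any as Any using (Any; here; there; any?)
open import Data.List.Membership.Propositional.Properties
  using (∈-++⁺ˡ; ∈-++⁺ʳ; ∈-++⁻; ∈-map⁺; ∈-map⁻; ∈-concatMap⁺; ∈-concatMap⁻;
         ∈-cartesianProduct⁺; ∈-cartesianProduct⁻; ∈-filter⁺; ∈-filter⁻)
open import Data.List.Properties using (filter-notAll)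
import Data.List.Relation.Binary.Sublist.Propositional as Sublist
open import Data.List.Relation.Binary.Sublist.Propositional.Properties using (filter-⊆)
open import Data.Sum using (_⊎_; inj₁; inj₂; [_,_])
open import Function using (_∘_)
open import Relation.Nullary using (¬_; Dec; yes; no; does; contradiction)
open import Relation.Nullary.Decidable using (map′; _×-dec_; _⊎-dec_; _→-dec_)
open import Relation.Binary.Definitions using (DecidableEquality; Decidable)
open import Relation.Binary.PropositionalEquality using (_≡_; _≢_; refl; sym; trans; cong)
open import Relation.Binary.Construct.Closure.ReflexiveTransitive as Star using (Star; ε; _◅_; _◅◅_)
open import Relation.Binary.Construct.Closure.Transitive as Transitive using (TransClosure; _∷_)
import Data.Nat as ℕ

_≟ᴸ_ : DecidableEquality Lit
pos m ≟ᴸ pos n = map′ (cong pos) (λ { refl → refl }) (m ℕ.≟ n)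
neg m ≟ᴸ neg n = map′ (cong neg) (λ { refl → refl }) (m ℕ.≟ n)
pos _ ≟ᴸ neg _ = no λ ()
neg _ ≟ᴸ pos _ = no λ ()

_∈ˢ?_ : (l : Lit) (X : LitSet) → Dec (l ∈ˢ X)
l ∈ˢ? X = X l Bool.≟ true

_∉ˢ?_ : (l : Lit) (X : LitSet) → Dec (l ∉ˢ X)
l ∉ˢ? X = X l Bool.≟ false

∉-anti : ∀ {Y X : LitSet} {l} → Y ⊑ X → l ∉ˢ X → l ∉ˢ Y
∉-anti {Y} {X} {l} Y⊑X l∉X with Y l in l∈?Y
... | false = refl
... | true  = contradiction (trans (sym (Y⊑X l l∈?Y)) l∉X) λ ()

∉-≢ : ∀ {X : LitSet} {l l′} → l ∉ˢ X → l′ ∈ˢ X → l ≢ l′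
∉-≢ l∉X l′∈X refl = contradiction (trans (sym l′∈X) l∉X) λ ()

consistent-⊑ : ∀ {Y X : LitSet} → Y ⊑ X → Consistent X → Consistent Y
consistent-⊑ Y⊑X cX a (p , q) = cX a (Y⊑X _ p , Y⊑X _ q)

-- Y satisfies the rule ρ of the reduct with respect to X: ρ is only present
-- in the reduct when none of its default-negated literals is in X.
ReductSat : LitSet → LitSet → Rule → Set
ReductSat X Y ρ = All (_∈ˢ Y) (body ρ) → All (_∉ˢ X) (nots ρ) → Any (_∈ˢ Y) (head ρ)

reductSat-mono : ∀ {X X′ Y : LitSet} {ρ} → X ⊑ X′ → ReductSat X Y ρ → ReductSat X′ Y ρ
reductSat-mono X⊑X′ sat body∈ nots∉ = sat body∈ (All.map (∉-anti X⊑X′) nots∉)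

any-false⇒All∉ : ∀ (X : LitSet) ls → any X ls ≡ false → All (_∉ˢ X) ls
any-false⇒All∉ X [] _ = []
any-false⇒All∉ X (l ∷ ls) p with X l in l∈?X
... | false = l∈?X ∷ any-false⇒All∉ X ls p

All∉⇒any-false : ∀ {X : LitSet} {ls} → All (_∉ˢ X) ls → any X ls ≡ false
All∉⇒any-false [] = refl
All∉⇒any-false (l∉X ∷ ls∉X) rewrite l∉X = All∉⇒any-false ls∉X

reduct-sat⁻ : ∀ Q (X Y : LitSet) → SatisfiesP Y (reduct Q X) → All (ReductSat X Y) Q
reduct-sat⁻ [] X Y _ = []
reduct-sat⁻ (ρ ∷ Q) X Y sat with any X (nots ρ) in survives
... | true = (λ _ nots∉ → contradiction (trans (sym survives) (All∉⇒any-false nots∉)) λ ())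
               ∷ reduct-sat⁻ Q X Y sat
reduct-sat⁻ (ρ ∷ Q) X Y (satρ ∷ sat) | false = (λ body∈ _ → satρ body∈ []) ∷ reduct-sat⁻ Q X Y sat

reduct-sat⁺ : ∀ Q (X Y : LitSet) → All (ReductSat X Y) Q → SatisfiesP Y (reduct Q X)
reduct-sat⁺ [] X Y _ = []
reduct-sat⁺ (ρ ∷ Q) X Y (satρ ∷ sat) with any X (nots ρ) in survives
... | true  = reduct-sat⁺ Q X Y sat
... | false = (λ body∈ _ → satρ body∈ (any-false⇒All∉ X (nots ρ) survives)) ∷ reduct-sat⁺ Q X Y sat

withCR-sat⁻ : ∀ P R (X Y : LitSet) → SatisfiesP Y (reduct (withCR P R) X) →
  All (ReductSat X Y) (reg P) × All (ReductSat X Y ∘ α) R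
withCR-sat⁻ P R X Y sat =
  let regSat , crSat = AllP.++⁻ (reg P) (reduct-sat⁻ (withCR P R) X Y sat)
  in regSat , AllP.map⁻ crSat

withCR-sat⁺ : ∀ P R (X Y : LitSet) → All (ReductSat X Y) (reg P) → All (ReductSat X Y ∘ α) R →
  SatisfiesP Y (reduct (withCR P R) X)
withCR-sat⁺ P R X Y regSat crSat = reduct-sat⁺ (withCR P R) X Y (AllP.++⁺ regSat (AllP.map⁺ crSat))

satisfies? : (X : LitSet) (ρ : Rule) → Dec (Satisfies X ρ)
satisfies? X ρ =
  all? (_∈ˢ? X) (body ρ) →-dec all? (_∉ˢ? X) (nots ρ) →-dec any? (_∈ˢ? X) (head ρ)

Edges : Set
Edges = List (Lit × Lit)

ruleEdges : Rule → Edges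
ruleEdges ρ = cartesianProduct (body ρ) (head ρ)

-- The dependency graph of P is the graph of the A-Prolog program P^reg ∪ α(P^cr).
depEdges : CRProgram → Edges
depEdges P = concatMap ruleEdges (withCR P (cr P))

depEdges⁺ : ∀ P {ρ b h} → ρ ∈ withCR P (cr P) → b ∈ body ρ → h ∈ head ρ → (b , h) ∈ depEdges P
depEdges⁺ P ρ∈ b∈ h∈ = ∈-concatMap⁺ ruleEdges (Any.map (λ { refl → ∈-cartesianProduct⁺ b∈ h∈ }) ρ∈)

depEdges-reg : ∀ P {ρ b h} → ρ ∈ reg P → b ∈ body ρ → h ∈ head ρ → (b , h) ∈ depEdges P
depEdges-reg P ρ∈ = depEdges⁺ P (∈-++⁺ˡ ρ∈)

depEdges-cr : ∀ P {r b} → r ∈ cr P → b ∈ crbody r → (b , crhead r) ∈ depEdges P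
depEdges-cr P r∈ b∈ = depEdges⁺ P (∈-++⁺ʳ (reg P) (∈-map⁺ α r∈)) b∈ (here refl)

depEdges-sound : ∀ P {b h} → (b , h) ∈ depEdges P → Edge P b h
depEdges-sound P e∈ with find (∈-concatMap⁻ ruleEdges e∈)
... | ρ , ρ∈ , e∈ρ with ∈-cartesianProduct⁻ (body ρ) (head ρ) e∈ρ | ∈-++⁻ (reg P) ρ∈
...   | b∈ , h∈ | inj₁ ρ∈reg = inj₁ (ρ , ρ∈reg , h∈ , b∈)
...   | b∈ , h∈ | inj₂ ρ∈cr with ∈-map⁻ α ρ∈cr
...     | r , r∈ , refl with h∈
...       | here h≡ = inj₂ (r , r∈ , h≡ , b∈)

Reach : Edges → Lit → Lit → Set
Reach es = Star (λ a b → (a , b) ∈ es)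

reach-split : ∀ {u v es a b} → Reach ((u , v) ∷ es) a b →
  Reach es a b ⊎ (Reach es a u × Reach es v b)
reach-split ε = inj₁ ε
reach-split (here refl ◅ rest) with reach-split rest
... | inj₁ v⇝b       = inj₂ (ε , v⇝b)
... | inj₂ (_ , v⇝b) = inj₂ (ε , v⇝b)
reach-split (there e∈ ◅ rest) with reach-split rest
... | inj₁ x⇝b         = inj₁ (e∈ ◅ x⇝b)
... | inj₂ (x⇝u , v⇝b) = inj₂ (e∈ ◅ x⇝u , v⇝b)

reach? : ∀ es → Decidable (Reach es)
reach? [] a b = map′ (λ { refl → ε }) (λ { ε → refl ; (() ◅ _) }) (a ≟ᴸ b)
reach? ((u , v) ∷ es) a b =
  map′ [ weaken , (λ (a⇝u , v⇝b) → weaken a⇝u ◅◅ here refl ◅ weaken v⇝b) ] reach-split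
       (reach? es a b ⊎-dec (reach? es a u ×-dec reach? es v b))
  where
    weaken : ∀ {x y} → Reach es x y → Reach ((u , v) ∷ es) x y
    weaken = Star.map there

star⇒trans : ∀ {A : Set} {R : A → A → Set} {a b} → Star R a b → a ≢ b → TransClosure R a b
star⇒trans ε a≢a = contradiction refl a≢a
star⇒trans {R = R} (e ◅ rest) _ = nonempty e rest
  where
    nonempty : ∀ {x y z} → R x y → Star R y z → TransClosure R x z
    nonempty e ε          = Transitive.[ e ]
    nonempty e (e′ ◅ es′) = e ∷ nonempty e′ es′

module Downstream (P : CRProgram) (X₁ X₂ : LitSet) where

  Fresh : Lit → Set
  Fresh c = c ∈ˢ X₂ × c ∉ˢ X₁

  Downstream : Lit → Set
  Downstream l = Any (λ c → Fresh c × Reach (depEdges P) c l) (crHeads P)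

  downstream? : ∀ l → Dec (Downstream l)
  downstream? l =
    any? (λ c → ((c ∈ˢ? X₂) ×-dec (c ∉ˢ? X₁)) ×-dec reach? (depEdges P) c l) (crHeads P)

  downstream-step : ∀ {b h} → Downstream b → (b , h) ∈ depEdges P → Downstream h
  downstream-step down e∈ = Any.map (λ (fresh , c⇝b) → fresh , c⇝b ◅◅ e∈ ◅ ε) down

  fresh-downstream : ∀ {c} → c ∈ crHeads P → Fresh c → Downstream c
  fresh-downstream c∈ fresh = lose c∈ (fresh , ε)

  Link : Set
  Link = Any (λ l → l ∈ˢ X₁ × Downstream l) (crHeads P)

  link? : Dec Link
  link? = any? (λ l → (l ∈ˢ? X₁) ×-dec downstream? l) (crHeads P)

  -- A downstream cr-literal of X₁ depends on a fresh cr-literal, which differs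
  -- from it since fresh literals are outside X₁.
  link-dependency : Link → ∃[ l₁ ] ∃[ l₂ ] (l₁ ∈ crHeads P × l₂ ∈ crHeads P × DependsOn P l₁ l₂)
  link-dependency link =
    let l , l∈ , l∈X₁ , down = find link
        c , c∈ , (_ , c∉X₁) , c⇝l = find down
    in l , c , l∈ , c∈ , star⇒trans (Star.map (depEdges-sound P) c⇝l)
                           (∉-≢ {X₁} c∉X₁ l∈X₁)

  module Extension (Y : LitSet) (Y⊑X₂ : Y ⊑ X₂) where

    Y⁺ : LitSet
    Y⁺ l = Y l ∨ (X₂ l ∧ does (downstream? l))

    Y⁺-inl : ∀ {l} → l ∈ˢ Y → l ∈ˢ Y⁺
    Y⁺-inl l∈Y rewrite l∈Y = refl

    Y⁺-inr : ∀ {l} → l ∈ˢ X₂ → Downstream l → l ∈ˢ Y⁺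
    Y⁺-inr {l} l∈X₂ down with downstream? l
    ... | no ¬down = contradiction down ¬down
    ... | yes _ rewrite l∈X₂ = ∨-zeroʳ (Y l)

    Y⁺-cases : ∀ l → l ∈ˢ Y⁺ → l ∈ˢ Y ⊎ (l ∈ˢ X₂ × Downstream l)
    Y⁺-cases l l∈ with Y l | X₂ l | downstream? l
    ... | true  | _    | _        = inj₁ refl
    ... | false | true | yes down = inj₂ (refl , down)
    Y⁺-cases l () | false | true  | no _
    Y⁺-cases l () | false | false | _

    Y⁺⊑X₂ : Y⁺ ⊑ X₂
    Y⁺⊑X₂ l l∈ = [ Y⊑X₂ l , proj₁ ] (Y⁺-cases l l∈)

    -- A rule of the graph which X₂ satisfies (reduct w.r.t. X₂) is satisfied
    -- by Y⁺ as soon as this holds when its whole body is in Y: a body literal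
    -- outside Y is downstream, and then so is every head literal.
    Y⁺-sat : ∀ ρ → (∀ {b h} → b ∈ body ρ → h ∈ head ρ → (b , h) ∈ depEdges P) →
      ReductSat X₂ X₂ ρ →
      (All (_∈ˢ Y) (body ρ) → All (_∉ˢ X₂) (nots ρ) → Any (_∈ˢ Y⁺) (head ρ)) →
      ReductSat X₂ Y⁺ ρ
    Y⁺-sat ρ edges satX₂ bodyInY body∈ nots∉ with all? (_∈ˢ? Y) (body ρ)
    ... | yes body∈Y = bodyInY body∈Y nots∉
    ... | no body∉Y =
      let b , b∈ , b∉Y = find (¬All⇒Any¬ (_∈ˢ? Y) (body ρ) body∉Y)
          h , h∈ , h∈X₂ = find (satX₂ (All.map (Y⁺⊑X₂ _) body∈) nots∉)
          b-down = [ (λ b∈Y → contradiction b∈Y b∉Y) , proj₂ ] (Y⁺-cases b (All.lookup body∈ b∈))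
      in lose h∈ (Y⁺-inr h∈X₂ (downstream-step b-down (edges b∈ h∈)))

NoSmallerSupport : CRProgram → List CRRule → Set
NoSmallerSupport P R =
  ∀ R′ → R′ Sublist.⊆ cr P → length R′ ℕ.< length R → ¬ ConsistentProgram (withCR P R′)

module Comparison (P : CRProgram) {X₁ X₂ : LitSet} {R₁ R₂ : List CRRule}
  (R₁⊆ : R₁ Sublist.⊆ cr P) (R₂⊆ : R₂ Sublist.⊆ cr P)
  (noSmaller₁ : NoSmallerSupport P R₁) (noSmaller₂ : NoSmallerSupport P R₂)
  (ans₁ : AnswerSet (withCR P R₁) X₁) (ans₂ : AnswerSet (withCR P R₂) X₂)
  (X₁⊏X₂ : X₁ ⊏ X₂) where

  open Downstream P X₁ X₂

  private
    X₁⊑X₂ = proj₁ X₁⊏X₂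
    sat₁ = withCR-sat⁻ P R₁ X₁ X₁ (proj₁ (proj₂ ans₁))
    sat₂ = withCR-sat⁻ P R₂ X₂ X₂ (proj₁ (proj₂ ans₂))
    minimal₁ = proj₂ (proj₂ ans₁)
    minimal₂ = proj₂ (proj₂ ans₂)

  T : List CRRule
  T = filter (satisfies? X₁ ∘ α) R₂

  -- If X₁ satisfies all of R₂, it is a model of the reduct of P^reg ∪ α(R₂)
  -- with respect to X₂, so X₂ is not minimal when X₁ ⊏ X₂.
  all-satisfied-absurd : ¬ All (Satisfies X₁ ∘ α) R₂
  all-satisfied-absurd satR₂ =
    minimal₂ X₁ (proj₁ ans₁) X₁⊏X₂
      (withCR-sat⁺ P R₂ X₂ X₁ (All.map (reductSat-mono X₁⊑X₂) (proj₁ sat₁))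
                                (All.map (reductSat-mono X₁⊑X₂) satR₂))

  -- Assuming no cr-literal of X₁ is downstream, a model Y ⊏ X₁ of the reduct of
  -- P^reg ∪ α(T) yields a model of the reduct of P^reg ∪ α(R₁).
  module SmallerModel
    (¬link : ¬ Link)
    (Y : LitSet) (Y⊑X₁ : Y ⊑ X₁) (satY : SatisfiesP Y (reduct (withCR P T) X₁)) where

    private
      Y⊑X₂ : Y ⊑ X₂
      Y⊑X₂ l = X₁⊑X₂ l ∘ Y⊑X₁ l
      satYreg = proj₁ (withCR-sat⁻ P T X₁ Y satY)
      satYcr  = proj₂ (withCR-sat⁻ P T X₁ Y satY)

    open Extension Y Y⊑X₂

    regular-Y⁺ : ∀ {ρ} → ρ ∈ reg P → ReductSat X₂ Y⁺ ρ
    regular-Y⁺ {ρ} ρ∈ = Y⁺-sat ρ (depEdges-reg P ρ∈) (All.lookup (proj₁ sat₂) ρ∈)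
      λ body∈Y nots∉ → Any.map Y⁺-inl
        (All.lookup satYreg ρ∈ body∈Y (All.map (∉-anti X₁⊑X₂) nots∉))

    -- For r ∈ R₂ with body in Y: if its head is in X₁ then r ∈ T and Y supplies
    -- the head; otherwise the head is a fresh cr-literal.
    cr-Y⁺ : ∀ {r} → r ∈ R₂ → ReductSat X₂ Y⁺ (α r)
    cr-Y⁺ {r} r∈ = Y⁺-sat (α r) (λ { b∈ (here refl) → depEdges-cr P r∈cr b∈ })
      satX₂ headFromY
      where
        r∈cr = Sublist.lookup R₂⊆ r∈
        satX₂ = All.lookup (proj₂ sat₂) r∈
        headFromY : All (_∈ˢ Y) (crbody r) → All (_∉ˢ X₂) (crnots r) →
          Any (_∈ˢ Y⁺) (crhead r ∷ [])
        headFromY body∈Y nots∉ with crhead r ∈ˢ? X₁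
        ... | yes h∈X₁ = Any.map Y⁺-inl
          (All.lookup satYcr (∈-filter⁺ (satisfies? X₁ ∘ α) r∈ (λ _ _ → here h∈X₁))
            body∈Y (All.map (∉-anti X₁⊑X₂) nots∉))
        ... | no h∉X₁ with satX₂ (All.map (Y⊑X₂ _) body∈Y) nots∉
        ...   | here h∈X₂ =
          here (Y⁺-inr h∈X₂ (fresh-downstream (∈-map⁺ crhead r∈cr) (h∈X₂ , ¬-not h∉X₁)))

    -- Y⁺ is a model of the reduct of P^reg ∪ α(R₂) below X₂, hence X₂ itself.
    Y⁺-covers : ∀ l → l ∈ˢ X₂ → l ∈ˢ Y⁺
    Y⁺-covers l l∈X₂ with Y⁺ l in l∈?
    ... | true  = refl
    ... | false = ⊥-elim (minimal₂ Y⁺ (consistent-⊑ Y⁺⊑X₂ (proj₁ ans₂))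
                    (Y⁺⊑X₂ , l , l∈X₂ , l∈?)
                    (withCR-sat⁺ P R₂ X₂ Y⁺ (All.tabulate regular-Y⁺) (All.tabulate cr-Y⁺)))

    -- Every cr-rule of R₁ holds in Y: its head is in X₁ ⊑ X₂, hence in
    -- Y⁺, and it is not downstream by assumption.
    cr-Y : ∀ {r} → r ∈ R₁ → ReductSat X₁ Y (α r)
    cr-Y {r} r∈ body∈Y nots∉ with All.lookup (proj₂ sat₁) r∈ (All.map (Y⊑X₁ _) body∈Y) nots∉
    ... | here h∈X₁ with Y⁺-cases (crhead r) (Y⁺-covers (crhead r) (X₁⊑X₂ _ h∈X₁))
    ...   | inj₁ h∈Y          = here h∈Y
    ...   | inj₂ (_ , h-down) =
      ⊥-elim (¬link (lose (∈-map⁺ crhead (Sublist.lookup R₁⊆ r∈)) (h∈X₁ , h-down)))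

    satisfies-R₁ : SatisfiesP Y (reduct (withCR P R₁) X₁)
    satisfies-R₁ = withCR-sat⁺ P R₁ X₁ Y satYreg (All.tabulate cr-Y)

  answerSet-T : ¬ Link → AnswerSet (withCR P T) X₁
  answerSet-T ¬link = proj₁ ans₁ , satT , minimalT
    where
      satT : SatisfiesP X₁ (reduct (withCR P T) X₁)
      satT = withCR-sat⁺ P T X₁ X₁ (proj₁ sat₁)
               (All.tabulate λ r∈ → proj₂ (∈-filter⁻ (satisfies? X₁ ∘ α) {xs = R₂} r∈))
      minimalT : ∀ Y → Consistent Y → Y ⊏ X₁ → ¬ SatisfiesP Y (reduct (withCR P T) X₁)
      minimalT Y cY Y⊏X₁ satY =
        minimal₁ Y cY Y⊏X₁ (SmallerModel.satisfies-R₁ ¬link Y (proj₁ Y⊏X₁) satY)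

  -- Without a link, T is a support smaller than R₁ (unless T = R₂, which
  -- contradicts minimality of X₂), contradicting minimality of R₁.
  no-link-absurd : ¬ Link → ⊥
  no-link-absurd ¬link with all? (satisfies? X₁ ∘ α) R₂
  ... | yes satR₂ = all-satisfied-absurd satR₂
  ... | no unsatR₂ =
    noSmaller₁ T (Sublist.⊆-trans (filter-⊆ (satisfies? X₁ ∘ α) R₂) R₂⊆)
      (<-≤-trans |T|<|R₂| |R₂|≤|R₁|) (X₁ , answerSet-T ¬link)
    where
      |R₂|≤|R₁| = ≮⇒≥ λ |R₁|<|R₂| → noSmaller₂ R₁ R₁⊆ |R₁|<|R₂| (X₁ , ans₁)
      |T|<|R₂| = filter-notAll (satisfies? X₁ ∘ α) R₂ (¬All⇒Any¬ (satisfies? X₁ ∘ α) R₂ unsatR₂)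

lemma10 : (P : CRProgram) → Nondisjunctive P → Acyclic P →
    (X₁ X₂ : LitSet) → CRAnswerSet P X₁ → CRAnswerSet P X₂ → X₁ ⊏ X₂ →
    ∃[ l₁ ] ∃[ l₂ ] (l₁ ∈ crHeads P × l₂ ∈ crHeads P × DependsOn P l₁ l₂)
lemma10 P _ _ X₁ X₂ (R₁ , (R₁⊆ , _ , noSmaller₁) , ans₁) (R₂ , (R₂⊆ , _ , noSmaller₂) , ans₂) X₁⊏X₂
  with Downstream.link? P X₁ X₂
... | yes link = Downstream.link-dependency P X₁ X₂ link
... | no ¬link =
  ⊥-elim (Comparison.no-link-absurd P R₁⊆ R₂⊆ noSmaller₁ noSmaller₂ ans₁ ans₂ X₁⊏X₂ ¬link)
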